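{- Let $P=(V,\le)$ be a well-founded, level finite interval order. Let $x\in \mathrm{Min}(P)$ be such that $U(x)$ is a maximal element of the poset $(\{U(t): t\in \mathrm{Min}(P)\},\subseteq)$. Then $U(x)=V\setminus \mathrm{Min}(P)$; equivalently, $\mathrm{Min}(P)$ is the only maximal antichain of $P$ containing $x$.
   Context: A poset is an interval order if it is isomorphic to a set of nonempty intervals of some chain, ordered by $I<J$ iff $x<y$ for all $x\in I$, $y\in J$. $\mathrm{Min}(P)$ is the set of minimal elements of $P$ and $U(x)=\{y: y>x\}$. The levels of a well-founded poset are defined by transfinite induction: $P_l=\mathrm{Min}(P\setminus\bigcup_{l'<l}P_{l'})$; $P$ is level finite if each level is finite. -}

module Defs where

open import Level using (0ℓ)
open import Data.Product using (Σ; _×_; _,_; ∃)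
open import Data.Sum using (_⊎_)
open import Data.Empty using (⊥)
open import Data.List using (List)
open import Data.List.Relation.Unary.Any using (Any)
open import Relation.Nullary using (¬_)
open import Relation.Binary.Bundles using (Poset; TotalOrder)
open import Induction.WellFounded using (WellFounded)

module PosetNotions (P : Poset 0ℓ 0ℓ 0ℓ) where
  open Poset P renaming (Carrier to V)

  _<_ : V → V → Set
  x < y = (x ≤ y) × ¬ (x ≈ y)

  Pred : Set₁
  Pred = V → Set

  Min : Pred
  Min m = ∀ y → ¬ (y < m)

  U : V → Pred
  U x y = x < y

  _⊆_ : Pred → Pred → Set
  A ⊆ B = ∀ v → A v → B v

  _≐_ : Pred → Pred → Set
  A ≐ B = (A ⊆ B) × (B ⊆ A)

  MinOutside : Pred → Pred
  MinOutside D m = ¬ D m × (∀ y → ¬ D y → ¬ (y < m))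

  -- Stage D : D is of the form ⋃_{l' < l} P_{l'} for some ordinal l
  -- (transfinite construction of the levels: unions of families of stages
  --  cover 0 and limits; successor adds the next level).
  data Stage : Pred → Set₁ where
    union : (I : Set) (D : I → Pred) → (∀ i → Stage (D i)) →
            Stage (λ v → Σ I (λ i → D i v))
    next  : (D : Pred) → Stage D → Stage (λ v → D v ⊎ MinOutside D v)

  -- the levels of P are the sets P_l = Min(P \ ⋃_{l'<l} P_{l'})
  IsLevel : Pred → Set₁
  IsLevel L = Σ Pred (λ D → Stage D × (L ≐ MinOutside D))

  Finite : Pred → Set
  Finite A = Σ (List V) (λ xs → ∀ v → A v → Any (v ≈_) xs)

  LevelFinite : Set₁
  LevelFinite = ∀ L → IsLevel L → Finite L

  WellFoundedPoset : Set
  WellFoundedPoset = WellFounded _<_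

  -- interval orders: isomorphic to a set of nonempty intervals of a chain C,
  -- ordered by I < J iff a < b for all a ∈ I, b ∈ J.
  module _ (C : TotalOrder 0ℓ 0ℓ 0ℓ) where
    private
      module C = TotalOrder C

    _<C_ : C.Carrier → C.Carrier → Set
    a <C b = (a C.≤ b) × ¬ (a C.≈ b)

    IsInterval : (C.Carrier → Set) → Set
    IsInterval I = (Σ C.Carrier I)
                 × (∀ a b c → I a → I c → a C.≤ b → b C.≤ c → I b)

    IsIntervalRepresentation : (V → C.Carrier → Set) → Set
    IsIntervalRepresentation I =
        (∀ v → IsInterval (I v))
      -- intervals are taken up to the equality of the chain
      × (∀ v a b → a C.≈ b → I v a → I v b)
      × (∀ v w → (∀ a → I v a → I w a) → (∀ a → I w a → I v a) → v ≈ w)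
      × (∀ v w → (v < w) ⇔' (∀ a b → I v a → I w b → a <C b))
      where
        _⇔'_ : Set → Set → Set
        A ⇔' B = (A → B) × (B → A)

  IsIntervalOrder : Set₁
  IsIntervalOrder = Σ (TotalOrder 0ℓ 0ℓ 0ℓ) (λ C →
                      Σ (V → TotalOrder.Carrier C → Set) (λ I →
                        IsIntervalRepresentation C I))

-- Interval orders are (2+2)-free: if a < c and b < d
-- with b ≮ c, then a < d.  Let v be non-minimal; by well-foundedness some
-- minimal m lies below v.  If x ≮ v, then 2+2-freeness applied to m < v and
-- x < d gives m < d, i.e. U(x) ⊆ U(m); maximality of U(x) forces
-- U(m) ⊆ U(x), so x < v after all.  Hence every non-minimal element is above x.
module Submission where

open import Defs
open import Level using (0ℓ)
open import Data.Product using (Σ; _×_; _,_; proj₁; proj₂)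
open import Relation.Nullary using (¬_; yes; no)
open import Relation.Binary.Bundles using (Poset; TotalOrder)
import Relation.Binary.Properties.Poset as PosetProperties
import Relation.Binary.Properties.TotalOrder as TotalOrderProperties
open import Induction.WellFounded using (Acc; acc)
open import Axiom.ExcludedMiddle using (ExcludedMiddle)
open import Axiom.DoubleNegationElimination using (em⇒dne)

module _ (P : Poset 0ℓ 0ℓ 0ℓ) where
  open Poset P renaming (Carrier to V)
  open PosetNotions P
  open PosetProperties P using (<-trans)

  module _ (em : ExcludedMiddle 0ℓ) where

    minimal-below-acc : ∀ v → Acc _<_ v → ¬ Min v → Σ V λ m → Min m × m < v
    minimal-below-acc v (acc rs) v∉Min with em⇒dne em (λ no-y<v → v∉Min λ y y<v → no-y<v (y , y<v))
    ... | y , y<v with em {Min y}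
    ...   | yes y∈Min = y , y∈Min , y<v
    ...   | no  y∉Min with minimal-below-acc y (rs y<v) y∉Min
    ...     | m , m∈Min , m<y = m , m∈Min , <-trans m<y y<v

    minimal-below : WellFoundedPoset → ∀ v → ¬ Min v → Σ V λ m → Min m × m < v
    minimal-below wf v = minimal-below-acc v (wf v)

  intervalOrder⇒2+2-free : IsIntervalOrder → ∀ {a b c d} → a < c → b < d → ¬ b < c → a < d
  intervalOrder⇒2+2-free (C , I , _ , _ , _ , iso) {a} {b} {c} {d} a<c b<d b≮c =
    proj₂ (iso a d) λ r s r∈a s∈d → ≰⇒> λ s≤r → b≮c (b<c r∈a s∈d s≤r)
    where
    module C = TotalOrder C
    open TotalOrderProperties C using (≰⇒>; ≤⇒≯)

    b<c : ∀ {r s} → I a r → I d s → s C.≤ r → b < c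
    b<c {r} {s} r∈a s∈d s≤r = proj₂ (iso b c) λ p q p∈b q∈c → ≰⇒> λ q≤p →
      let p<s = proj₁ (iso b d) b<d p s p∈b s∈d
          r<q = proj₁ (iso a c) a<c r q r∈a q∈c
      in ≤⇒≯ (C.trans q≤p (C.trans (proj₁ p<s) s≤r)) r<q

  U-maximal⇒U≐nonMinimal : ExcludedMiddle 0ℓ → WellFoundedPoset → IsIntervalOrder →
    ∀ x → (∀ t → Min t → U x ⊆ U t → U t ⊆ U x) → U x ≐ (λ v → ¬ Min v)
  U-maximal⇒U≐nonMinimal em wf io x maximal = (λ v x<v v∈Min → v∈Min x x<v) , above-x
    where
    above-x : ∀ v → ¬ Min v → x < v
    above-x v v∉Min with minimal-below em wf v v∉Min
    ... | m , m∈Min , m<v = em⇒dne em λ x≮v →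
      x≮v (maximal m m∈Min (λ d x<d → intervalOrder⇒2+2-free io m<v x<d x≮v) v m<v)

open PosetNotions

lemma2p4 : ExcludedMiddle 0ℓ →
    (P : Poset 0ℓ 0ℓ 0ℓ) →
    WellFoundedPoset P → LevelFinite P → IsIntervalOrder P →
    (x : Poset.Carrier P) → Min P x →
    (∀ t → Min P t → _⊆_ P (U P x) (U P t) → _⊆_ P (U P t) (U P x)) →
    _≐_ P (U P x) (λ v → ¬ Min P v)
lemma2p4 em P wf _ io x _ = U-maximal⇒U≐nonMinimal P em wf io x
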